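{- If $\Phi$ is a quadrangular embedding of a simple graph with $n$ vertices and $m$ edges, where $m>\frac12\binom{n}{2}$, then $\Phi$ is not polyhedral.
   Context: All graphs are simple. Embeddings are cellular embeddings in surfaces (connected compact 2-manifolds without boundary), i.e., every face is an open disc. An embedding is quadrangular if every face is bounded by a $4$-cycle. An embedding is polyhedral if every face is bounded by a cycle and any two distinct faces touch at most once, meaning that the intersection of their boundaries is empty, a single vertex, or a single edge. -}

module Defs where

open import Data.Nat using (ℕ)
open import Data.Fin using (Fin; zero; suc)
open import Data.Product using (Σ; ∃; ∃-syntax; _×_; _,_)
open import Data.Sum using (_⊎_)
open import Relation.Binary.PropositionalEquality using (_≡_; _≢_)
open import Relation.Binary.Construct.Closure.ReflexiveTransitive using (Star)
open import Function.Definitions using (Injective)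

-- Simple graphs on vertex set Fin n with m edges, given by an
-- enumeration  E : Fin m → Fin n × Fin n  of the edges (as ordered
-- representatives of unordered pairs).

SamePair : ∀ {n} → Fin n → Fin n → Fin n → Fin n → Set
SamePair a b c d = (a ≡ c × b ≡ d) ⊎ (a ≡ d × b ≡ c)

record SimpleGraph (n m : ℕ) : Set where
  field
    edge      : Fin m → Fin n × Fin n
    loopless  : ∀ e {u v} → edge e ≡ (u , v) → u ≢ v
    noMulti   : ∀ e e' {u v u' v'} → edge e ≡ (u , v) → edge e' ≡ (u' , v') →
                SamePair u v u' v' → e ≡ e'

  Joins : Fin m → Fin n → Fin n → Set
  Joins e u v = ∃[ a ] ∃[ b ] (edge e ≡ (a , b) × SamePair a b u v)

  Adj : Fin n → Fin n → Set
  Adj u v = ∃[ e ] Joins e u v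

  Connected : Set
  Connected = ∀ u v → Star Adj u v

open SimpleGraph public

next : Fin 4 → Fin 4
next zero = suc zero
next (suc zero) = suc (suc zero)
next (suc (suc zero)) = suc (suc (suc zero))
next (suc (suc (suc zero))) = zero

prev : Fin 4 → Fin 4
prev zero = suc (suc (suc zero))
prev (suc zero) = zero
prev (suc (suc zero)) = suc zero
prev (suc (suc (suc zero))) = suc (suc zero)

-- A quadrangular (cellular) embedding of G in a closed surface,
-- described combinatorially: a finite family of faces, each bounded by
-- a 4-cycle of G, such that the faces glue to a closed connected surface
-- (each edge lies on exactly two faces, the faces around each vertex
-- form a single cycle (the link of every vertex is a circle), every
-- vertex lies on a face, and the graph is connected).

module _ {n m : ℕ} (G : SimpleGraph n m) where

  record QuadEmbedding : Set where
    field
      nFaces : ℕ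
      face   : Fin nFaces → Fin 4 → Fin n
      faceInj   : ∀ i → Injective _≡_ _≡_ (face i)
      faceAdj   : ∀ i k → Adj G (face i k) (face i (next k))

    EdgeOn : Fin m → Fin nFaces → Set
    EdgeOn e i = ∃[ k ] Joins G e (face i k) (face i (next k))

    VertexOn : Fin n → Fin nFaces → Set
    VertexOn v i = ∃[ k ] face i k ≡ v

    LinkAdj : Fin n → Fin n → Fin n → Set
    LinkAdj v a b = ∃[ i ] ∃[ k ] (face i k ≡ v ×
                      SamePair (face i (prev k)) (face i (next k)) a b)

    field
      connected   : Connected G
      twoFaces    : ∀ e → ∃[ i ] ∃[ j ] (i ≢ j × EdgeOn e i × EdgeOn e j ×
                      (∀ l → EdgeOn e l → l ≡ i ⊎ l ≡ j))
      vertexCovered : ∀ v → ∃[ i ] VertexOn v i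
      linkConnected : ∀ v a b → Adj G v a → Adj G v b → Star (LinkAdj v) a b

    TouchAtMostOnce : Fin nFaces → Fin nFaces → Set
    TouchAtMostOnce i j =
      (∀ u v → VertexOn u i → VertexOn u j → VertexOn v i → VertexOn v j → u ≡ v)
      ⊎ (∃[ e ] (EdgeOn e i × EdgeOn e j ×
          (∀ w → VertexOn w i → VertexOn w j → ∃[ x ] Joins G e w x)))

    -- polyhedral (faces are already bounded by cycles)
    Polyhedral : Set
    Polyhedral = ∀ i j → i ≢ j → TouchAtMostOnce i j

open QuadEmbedding public

{-# OPTIONS --safe #-}
-- Orient every edge both ways and take every face diagonal in both orientations:
-- this gives 2m + 4f ordered pairs of distinct vertices, f the number of faces.
-- They are pairwise distinct when Φ is polyhedral, because a diagonal that is an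
-- edge, or a diagonal of two different faces, would make two faces share two
-- opposite corners of a quadrangle; these lie on no common side of it, so the
-- faces would touch more than once.
-- Hence 2m + 4f ≤ n(n − 1) = 2·C(n,2), while 2m ≤ 4f since each edge lies on
-- two faces, so 2m ≤ C(n,2).
module Submission where

open import Defs
open import Data.Nat using (ℕ; _*_; _>_)
open import Data.Nat.Combinatorics using (_C_)
open import Relation.Nullary using (¬_)

open import Data.Nat using (zero; suc; _+_; _∸_; _≤_; z≤n)
open import Data.Nat.Properties
  using (*-comm; *-distribˡ-+; *-distribʳ-+; +-identityʳ; +-monoʳ-≤; *-cancelˡ-≤; <⇒≱; module ≤-Reasoning)
open import Data.Nat.Combinatorics using (nC1≡n; nCk+nC[k+1]≡[n+1]C[k+1])
open import Data.Fin using (Fin; punchOut)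
open import Data.Fin.Patterns using (0F; 1F; 2F; 3F)
open import Data.Fin.Properties using (+↔⊎; *↔×; punchOut-injective; injective⇒≤; _≟_)
open import Data.Product using (Σ-syntax; ∃-syntax; _×_; _,_; proj₁; proj₂; uncurry; swap)
open import Data.Sum using (_⊎_; inj₁; inj₂; [_,_])
open import Data.Sum.Function.Propositional using (_⊎-↔_)
open import Data.Empty using (⊥-elim)
open import Relation.Nullary using (yes; no)
open import Relation.Binary.PropositionalEquality
  using (_≡_; _≢_; refl; sym; trans; cong; subst; module ≡-Reasoning)
open import Function using (_∘_)
open import Function.Definitions using (Injective)
open import Function.Bundles using (_↔_; _↣_; mk↣; Injection; Inverse)
open import Function.Properties.Inverse using (↔⇒↣; ↔-sym)
open import Function.Construct.Composition using (_↣-∘_; _↔-∘_)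

↣⇒≤ : ∀ {a b} {A B : Set} → Fin a ↔ A → Fin b ↔ B → A ↣ B → a ≤ b
↣⇒≤ a↔A b↔B A↣B = injective⇒≤ (Injection.injective (↔⇒↣ (↔-sym b↔B) ↣-∘ (A↣B ↣-∘ ↔⇒↣ a↔A)))

punchOut-pair-injective : ∀ {n} {a b a′ b′ : Fin (suc n)} (a≢b : a ≢ b) (a′≢b′ : a′ ≢ b′) →
  (a , punchOut a≢b) ≡ (a′ , punchOut a′≢b′) → (a , b) ≡ (a′ , b′)
punchOut-pair-injective a≢b a′≢b′ eq with cong proj₁ eq
... | refl = cong (_ ,_) (punchOut-injective a≢b a′≢b′ (cong proj₂ eq))

distinct-pairs-≤ : ∀ {a n} {A : Set} → Fin a ↔ A → (g : A → Fin n × Fin n) →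
  Injective _≡_ _≡_ g → (∀ x → uncurry _≢_ (g x)) → a ≤ n * (n ∸ 1)
distinct-pairs-≤ {zero}  {zero}  a↔A g _ _ = z≤n
distinct-pairs-≤ {suc a} {zero}  a↔A g _ _ with g (Inverse.to a↔A 0F)
... | () , _
distinct-pairs-≤ {n = suc n} a↔A g g-injective distinct =
  ↣⇒≤ a↔A *↔× (mk↣ {to = punched} punched-injective)
  where
  punched : _ → Fin (suc n) × Fin n
  punched x = proj₁ (g x) , punchOut (distinct x)

  punched-injective : Injective _≡_ _≡_ punched
  punched-injective {x} {y} eq =
    g-injective (punchOut-pair-injective (distinct x) (distinct y) eq)

double-nC2 : ∀ n → 2 * (n C 2) ≡ n * (n ∸ 1)
double-nC2 0 = refl
double-nC2 1 = refl
double-nC2 (suc (suc n)) = begin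
  2 * (suc (suc n) C 2)        ≡⟨ cong (2 *_) (nCk+nC[k+1]≡[n+1]C[k+1] (suc n) 1) ⟨
  2 * (suc n C 1 + suc n C 2)  ≡⟨ cong (λ c → 2 * (c + suc n C 2)) (nC1≡n (suc n)) ⟩
  2 * (suc n + suc n C 2)      ≡⟨ *-distribˡ-+ 2 (suc n) (suc n C 2) ⟩
  2 * suc n + 2 * (suc n C 2)  ≡⟨ cong (2 * suc n +_) (double-nC2 (suc n)) ⟩
  2 * suc n + suc n * n        ≡⟨ cong (2 * suc n +_) (*-comm (suc n) n) ⟩
  2 * suc n + n * suc n        ≡⟨ *-distribʳ-+ (suc n) 2 n ⟨
  suc (suc n) * suc n          ∎
  where open ≡-Reasoning

opposite : Fin 4 → Fin 4
opposite k = next (next k)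

opposite-irreflexive : ∀ k → opposite k ≢ k
opposite-irreflexive 0F ()
opposite-irreflexive 1F ()
opposite-irreflexive 2F ()
opposite-irreflexive 3F ()

opposite≢next : ∀ k → opposite k ≢ next k
opposite≢next 0F ()
opposite≢next 1F ()
opposite≢next 2F ()
opposite≢next 3F ()

opposite-next≢ : ∀ k → opposite (next k) ≢ k
opposite-next≢ 0F ()
opposite-next≢ 1F ()
opposite-next≢ 2F ()
opposite-next≢ 3F ()

OnSide : Fin 4 → Fin 4 → Set
OnSide k p = p ≡ k ⊎ p ≡ next k

opposites-not-on-one-side : ∀ k {p} → OnSide k p → ¬ OnSide k (opposite p)
opposites-not-on-one-side k (inj₁ refl) = [ opposite-irreflexive k , opposite≢next k ]
opposites-not-on-one-side k (inj₂ refl) = [ opposite-next≢ k , opposite-irreflexive (next k) ]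

module _ {n : ℕ} {a b c d : Fin n} where

  samePair-sym : SamePair a b c d → SamePair c d a b
  samePair-sym (inj₁ (refl , refl)) = inj₁ (refl , refl)
  samePair-sym (inj₂ (refl , refl)) = inj₂ (refl , refl)

  samePair-trans : ∀ {x y} → SamePair a b c d → SamePair c d x y → SamePair a b x y
  samePair-trans (inj₁ (refl , refl)) q = q
  samePair-trans (inj₂ (refl , refl)) (inj₁ (refl , refl)) = inj₂ (refl , refl)
  samePair-trans (inj₂ (refl , refl)) (inj₂ (refl , refl)) = inj₁ (refl , refl)

  samePair-head : SamePair a b c d → a ≡ c ⊎ a ≡ d
  samePair-head (inj₁ (a≡c , _)) = inj₁ a≡c
  samePair-head (inj₂ (a≡d , _)) = inj₂ a≡d

module _ {n m : ℕ} (G : SimpleGraph n m) where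

  joins-sym : ∀ {e a b} → Joins G e a b → Joins G e b a
  joins-sym (c , d , eq , p) = c , d , eq , samePair-trans p (inj₂ (refl , refl))

  joins-samePair : ∀ {e a b c d} → Joins G e a b → Joins G e c d → SamePair a b c d
  joins-samePair (a₀ , b₀ , eq , p) (c₀ , d₀ , eq′ , q) with trans (sym eq) eq′
  ... | refl = samePair-trans (samePair-sym p) q

  joins-unique : ∀ {e e′ a b} → Joins G e a b → Joins G e′ a b → e ≡ e′
  joins-unique {e} {e′} (a₀ , b₀ , eq , p) (a₁ , b₁ , eq′ , q) =
    noMulti G e e′ eq eq′ (samePair-trans p (samePair-sym q))

  arc : Fin m × Fin 2 → Fin n × Fin n
  arc (e , 0F) = edge G e
  arc (e , 1F) = swap (edge G e)

  arc-joins : ∀ x → uncurry (Joins G (proj₁ x)) (arc x)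
  arc-joins (e , 0F) = _ , _ , refl , inj₁ (refl , refl)
  arc-joins (e , 1F) = _ , _ , refl , inj₂ (refl , refl)

  arc-distinct : ∀ x → uncurry _≢_ (arc x)
  arc-distinct (e , 0F) = loopless G e refl
  arc-distinct (e , 1F) = loopless G e refl ∘ sym

  arc-injective : Injective _≡_ _≡_ arc
  arc-injective {e , b} {e′ , b′} eq
    with joins-unique (arc-joins (e , b)) (subst (uncurry (Joins G e′)) (sym eq) (arc-joins (e′ , b′)))
  arc-injective {e , 0F} {.e , 0F} eq | refl = refl
  arc-injective {e , 0F} {.e , 1F} eq | refl = ⊥-elim (arc-distinct (e , 0F) (cong proj₁ eq))
  arc-injective {e , 1F} {.e , 0F} eq | refl = ⊥-elim (arc-distinct (e , 0F) (cong proj₂ eq))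
  arc-injective {e , 1F} {.e , 1F} eq | refl = refl

  module _ (Φ : QuadEmbedding G) where

    Corner : Set
    Corner = Fin (nFaces Φ) × Fin 4

    -- A corner (i , k) also names the side of face i from corner k to corner next k.
    BordersSide : Fin m → Corner → Set
    BordersSide e (i , k) = Joins G e (face Φ i k) (face Φ i (next k))

    vertexOn-endpoint : ∀ {e i a b} → EdgeOn Φ e i → Joins G e a b → VertexOn Φ a i
    vertexOn-endpoint (k , on) ab with samePair-head (joins-samePair ab on)
    ... | inj₁ a≡k = k , sym a≡k
    ... | inj₂ a≡next-k = next k , sym a≡next-k

    endpoint-onSide : ∀ {e i k p w} → BordersSide e (i , k) → Joins G e (face Φ i p) w → OnSide k p
    endpoint-onSide {i = i} side pw with samePair-head (joins-samePair pw side)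
    ... | inj₁ p≡k = inj₁ (faceInj Φ i p≡k)
    ... | inj₂ p≡next-k = inj₂ (faceInj Φ i p≡next-k)

    edgeOn-another-face : ∀ e i → ∃[ j ] (i ≢ j × EdgeOn Φ e j)
    edgeOn-another-face e i with twoFaces Φ e
    ... | j₁ , j₂ , j₁≢j₂ , on₁ , on₂ , _ with i ≟ j₁
    ...   | yes refl = j₂ , j₁≢j₂ , on₂
    ...   | no i≢j₁ = j₁ , i≢j₁ , on₁

    sides : ∀ e → Σ[ c ∈ (Fin 2 → Corner) ] (Injective _≡_ _≡_ c × ∀ s → BordersSide e (c s))
    sides e with twoFaces Φ e
    ... | i , j , i≢j , (k , on-i) , (l , on-j) , _ = c , c-injective , c-borders
      where
      c : Fin 2 → Corner
      c 0F = i , k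
      c 1F = j , l

      c-injective : Injective _≡_ _≡_ c
      c-injective {0F} {0F} _ = refl
      c-injective {0F} {1F} eq = ⊥-elim (i≢j (cong proj₁ eq))
      c-injective {1F} {0F} eq = ⊥-elim (i≢j (sym (cong proj₁ eq)))
      c-injective {1F} {1F} _ = refl

      c-borders : ∀ s → BordersSide e (c s)
      c-borders 0F = on-i
      c-borders 1F = on-j

    sideCorner : Fin m × Fin 2 → Corner
    sideCorner (e , s) = proj₁ (sides e) s

    sideCorner-borders : ∀ x → BordersSide (proj₁ x) (sideCorner x)
    sideCorner-borders (e , s) = proj₂ (proj₂ (sides e)) s

    sideCorner-injective : Injective _≡_ _≡_ sideCorner
    sideCorner-injective {e , s} {e′ , s′} eq
      with joins-unique (sideCorner-borders (e , s)) (subst (BordersSide e′) (sym eq) (sideCorner-borders (e′ , s′)))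
    ... | refl = cong (e ,_) (proj₁ (proj₂ (sides e)) eq)

    sides≤corners : m * 2 ≤ nFaces Φ * 4
    sides≤corners = ↣⇒≤ *↔× *↔× (mk↣ sideCorner-injective)

    diagonal : Corner → Fin n × Fin n
    diagonal (i , k) = face Φ i k , face Φ i (opposite k)

    diagonal-distinct : ∀ x → uncurry _≢_ (diagonal x)
    diagonal-distinct (i , k) eq = opposite-irreflexive k (sym (faceInj Φ i eq))

    module _ (polyhedral : Polyhedral Φ) where

      opposite-corners-not-shared : ∀ {i j} → i ≢ j → ∀ k →
        VertexOn Φ (face Φ i k) j → ¬ VertexOn Φ (face Φ i (opposite k)) j
      opposite-corners-not-shared {i} {j} i≢j k on on′ with polyhedral i j i≢j
      ... | inj₁ single =
        opposite-irreflexive k (sym (faceInj Φ i (single _ _ (k , refl) on (opposite k , refl) on′)))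
      ... | inj₂ (e , (l , side) , _ , shared) =
        opposites-not-on-one-side l (endpoint-onSide side (proj₂ (shared _ (k , refl) on)))
                                    (endpoint-onSide side (proj₂ (shared _ (opposite k , refl) on′)))

      diagonal-not-edge : ∀ {e i} k → ¬ Joins G e (face Φ i k) (face Φ i (opposite k))
      diagonal-not-edge {e} {i} k joins with edgeOn-another-face e i
      ... | j , i≢j , on = opposite-corners-not-shared i≢j k
                             (vertexOn-endpoint on joins) (vertexOn-endpoint on (joins-sym joins))

      diagonal-injective : Injective _≡_ _≡_ diagonal
      diagonal-injective {i , k} {j , l} eq with i ≟ j
      ... | yes refl = cong (i ,_) (faceInj Φ i (cong proj₁ eq))
      ... | no i≢j = ⊥-elim (opposite-corners-not-shared i≢j k
                               (l , sym (cong proj₁ eq)) (opposite l , sym (cong proj₂ eq)))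

      arcOrDiagonal : (Fin m × Fin 2) ⊎ Corner → Fin n × Fin n
      arcOrDiagonal = [ arc , diagonal ]

      arcOrDiagonal-distinct : ∀ x → uncurry _≢_ (arcOrDiagonal x)
      arcOrDiagonal-distinct = [ arc-distinct , diagonal-distinct ]

      arcOrDiagonal-injective : Injective _≡_ _≡_ arcOrDiagonal
      arcOrDiagonal-injective {inj₁ x} {inj₁ y} eq = cong inj₁ (arc-injective eq)
      arcOrDiagonal-injective {inj₁ x} {inj₂ (i , k)} eq =
        ⊥-elim (diagonal-not-edge k (subst (uncurry (Joins G (proj₁ x))) eq (arc-joins x)))
      arcOrDiagonal-injective {inj₂ (i , k)} {inj₁ y} eq =
        ⊥-elim (diagonal-not-edge k (subst (uncurry (Joins G (proj₁ y))) (sym eq) (arc-joins y)))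
      arcOrDiagonal-injective {inj₂ x} {inj₂ y} eq = cong inj₂ (diagonal-injective eq)

      arcs+diagonals≤ : m * 2 + nFaces Φ * 4 ≤ n * (n ∸ 1)
      arcs+diagonals≤ = distinct-pairs-≤ ((*↔× ⊎-↔ *↔×) ↔-∘ +↔⊎)
        arcOrDiagonal arcOrDiagonal-injective arcOrDiagonal-distinct

lemma5p1 : (n m : ℕ) (G : SimpleGraph n m) (Φ : QuadEmbedding G) →
    2 * m > n C 2 → ¬ Polyhedral Φ
lemma5p1 n m G Φ 2m>nC2 polyhedral = <⇒≱ 2m>nC2 (*-cancelˡ-≤ 2 (begin
  2 * (2 * m)           ≡⟨ cong (2 *_) (*-comm 2 m) ⟩
  2 * (m * 2)           ≡⟨ cong (m * 2 +_) (+-identityʳ (m * 2)) ⟩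
  m * 2 + m * 2         ≤⟨ +-monoʳ-≤ (m * 2) (sides≤corners G Φ) ⟩
  m * 2 + nFaces Φ * 4  ≤⟨ arcs+diagonals≤ G Φ polyhedral ⟩
  n * (n ∸ 1)           ≡⟨ double-nC2 n ⟨
  2 * (n C 2)           ∎))
  where open ≤-Reasoning
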